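{- Let $G$ be a finite abelian group, let $S\subsetneq G$, let $L\le G_0\le G$ be subgroups and $g_0\in G_0$ such that: (L1) $G_0/L$ is a cyclic $2$-group of order at least $4$ and $\langle g_0\rangle+L=G_0$; (L2) $G/G_0$ is an elementary abelian $2$-group (possibly trivial); (L3) $\exp(G/L)=\exp(G_0/L)$; (L4) $S+L=(G\setminus G_0)\cup(g_0+L)$ and $S\cap(g_0+L)$ is not contained in a coset of a proper subgroup of $L$. Suppose moreover that $|S+L|-|S|\le|L|-1$. If $H$ is a subgroup of $G$ with $|S+H|-|S|\le|H|-1$ and $S+H\ne G$, then $H\le G_0$.
   Context: Group operation is written additively; $A+B=\{a+b:a\in A,b\in B\}$. -}

module Defs where

open import Level using (Level; _⊔_) renaming (suc to lsuc)
open import Algebra.Bundles using (AbelianGroup)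
open import Data.Bool using (Bool; true; false; _∧_; _∨_; not; if_then_else_)
open import Data.Nat using (ℕ; zero; suc; _≤_; _<_)
open import Data.List using (List; []; _∷_)
open import Data.Bool.ListAction using (any)
open import Data.List.Relation.Unary.Any using (Any)
open import Data.List.Relation.Unary.AllPairs using (AllPairs)
open import Data.Product using (Σ; ∃; _×_; _,_)
open import Relation.Nullary using (¬_)
open import Relation.Binary.PropositionalEquality using (_≡_)

-- A finite abelian group: a stdlib abelian group (written additively below)
-- together with a duplicate-free (up to ≈) complete enumeration of its elements.
record FiniteAbelianGroup (c ℓ : Level) : Set (lsuc (c ⊔ ℓ)) where
  field
    abelianGroup : AbelianGroup c ℓ
  open AbelianGroup abelianGroup public
  field
    enum     : List Carrier
    complete : ∀ x → Any (x ≈_) enum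
    distinct : AllPairs (λ a b → ¬ (a ≈ b)) enum

module Notions {c ℓ : Level} (G : FiniteAbelianGroup c ℓ) where
  open FiniteAbelianGroup G

  _+_ : Carrier → Carrier → Carrier
  x + y = x ∙ y

  0# : Carrier
  0# = ε

  -- (x - y = x ∙ y ⁻¹ is provided by the stdlib group structure)

  _·_ : ℕ → Carrier → Carrier
  zero  · x = ε
  suc n · x = x ∙ (n · x)

  record Subset : Set (c ⊔ ℓ) where
    field
      mem  : Carrier → Bool
      resp : ∀ {x y} → x ≈ y → mem x ≡ mem y
  open Subset public

  _∈_ : Carrier → Subset → Set
  x ∈ A = mem A x ≡ true

  _∉_ : Carrier → Subset → Set
  x ∉ A = mem A x ≡ false

  _⊆_ : Subset → Subset → Set c
  A ⊆ B = ∀ x → x ∈ A → x ∈ B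

  countIn : (Carrier → Bool) → List Carrier → ℕ
  countIn P []       = 0
  countIn P (x ∷ xs) = if P x then suc (countIn P xs) else countIn P xs

  ∣_∣ : Subset → ℕ
  ∣ A ∣ = countIn (mem A) enum

  record IsSubgroup (H : Subset) : Set c where
    field
      has-0   : 0# ∈ H
      closed+ : ∀ x y → x ∈ H → y ∈ H → (x + y) ∈ H
      closed- : ∀ x → x ∈ H → (x ⁻¹) ∈ H

  -- sumset A + B = {a + b : a ∈ A, b ∈ B};  x ∈ A + B  iff  ∃ a ∈ A, x - a ∈ B
  _⊕_ : Subset → Subset → Subset
  mem  (A ⊕ B) x = any (λ a → mem A a ∧ mem B (x - a)) enum
  resp (A ⊕ B) {x} {y} x≈y = go enum
    where
    go : ∀ l → any (λ a → mem A a ∧ mem B (x - a)) l ≡ any (λ a → mem A a ∧ mem B (y - a)) l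
    go [] = Relation.Binary.PropositionalEquality.refl
    go (a ∷ l) rewrite resp B {x - a} {y - a} (∙-congʳ x≈y) | go l = Relation.Binary.PropositionalEquality.refl

  _∈⟨_⟩+_ : Carrier → Carrier → Subset → Set (c ⊔ ℓ)
  x ∈⟨ g ⟩+ L = ∃ λ (n : ℕ) → Σ Carrier λ l → (l ∈ L) × (x ≈ ((n · g) + l))

  _∈_+ₛ_ : Carrier → Carrier → Subset → Set
  x ∈ g +ₛ L = (x - g) ∈ L

  -- e is the exponent of the quotient A/L (L ≤ A): the least positive e
  -- with e·x ∈ L for all x ∈ A
  Annihilates : ℕ → Subset → Subset → Set c
  Annihilates m A L = ∀ x → x ∈ A → (m · x) ∈ L

  IsExponentMod : Subset → Subset → ℕ → Set c
  IsExponentMod A L e = (0 < e) × Annihilates e A L × (∀ m → 0 < m → Annihilates m A L → e ≤ m)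

  Univ : Subset
  mem  Univ x = true
  resp Univ _ = Relation.Binary.PropositionalEquality.refl

-- Suppose h ∈ H ∖ G₀ and x₀ ∉ S + H, and put D = (G ∖ G₀) ∖ S. By (L4), D ⊆ (S + L) ∖ S,
-- so |D| < |L|, and G₀ ∩ S ⊆ g₀ + L. Translation by −h maps G₀ ∖ (S + H) into D, hence
-- |G₀| ≤ |L| + |(S + H) ∖ S| + |D| < |L| + |H| + |D|. The coset x₀ + H misses S, so
-- (x₀ + H) ∖ G₀ ⊆ D, and translation by h maps (x₀ + H) ∩ G₀ into (x₀ + H) ∖ G₀; thus
-- |H| ≤ 2|D|. Altogether |G₀| < |L| + 3|D| < 4|L|, contradicting [G₀ : L] ≥ 4.
-- Only this index bound and the description of S + L in (L4) are needed.

module Submission where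

open import Defs
open import Data.Bool using (Bool; true; false; not; _∧_; _∨_)
open import Data.Bool.Properties using (∧-conicalˡ; ∧-conicalʳ; not-injective; ¬-not; T-≡)
open import Data.Empty using (⊥-elim)
open import Data.Integer as ℤ using (+_)
import Data.Integer.Properties as ℤP
open import Data.Integer.Solver using (module +-*-Solver)
open import Data.List using ([]; _∷_)
open import Data.List.Relation.Unary.All as All using (All; []; _∷_)
open import Data.List.Relation.Unary.AllPairs using (AllPairs; []; _∷_)
open import Data.List.Relation.Unary.Any as Any using (Any; here; there; _─_)
open import Data.List.Relation.Unary.Any.Properties using (any⁺)
open import Data.Nat using (ℕ; suc; _*_; _^_; _≤_; _<_; z≤n; s≤s)
open import Data.Nat.Properties
  using (≤-refl; ≤-trans; <⇒≤; <⇒≱; <-≤-trans; ≤-<-trans; +-suc; +-comm; +-cancelʳ-<;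
         +-mono-≤; +-monoˡ-≤; +-monoʳ-≤; +-monoˡ-<; +-monoʳ-<; *-monoˡ-≤; ^-monoʳ-≤;
         module ≤-Reasoning)
import Data.Nat.Tactic.RingSolver as ℕ-Ring
open import Data.Product using (Σ; ∃; _×_; _,_; proj₁; proj₂)
open import Function using (_∘_; id)
open import Function.Bundles using (_⇔_; Equivalence)
open import Level using (Level)
open import Relation.Nullary using (¬_)
open import Relation.Binary.PropositionalEquality
  using (_≡_; refl; sym; trans; cong; cong₂; subst; subst₂)

module Arithmetic where
  open import Data.Nat using (_+_)

  +a-+b≤+c-1⇒a<c+b : ∀ a b c → (+ a) ℤ.- (+ b) ℤ.≤ (+ c) ℤ.- (+ 1) → a < c + b
  +a-+b≤+c-1⇒a<c+b a b c gap =
    ℤP.drop‿+≤+ (subst₂ ℤ._≤_ lhs rhs (ℤP.+-monoˡ-≤ (+ b ℤ.+ + 1) gap))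
    where
    open +-*-Solver
    lhs : (+ a ℤ.- + b) ℤ.+ (+ b ℤ.+ + 1) ≡ + 1 ℤ.+ + a
    lhs = solve 2 (λ x y → (x :- y) :+ (y :+ con (+ 1)) := con (+ 1) :+ x) refl (+ a) (+ b)
    rhs : (+ c ℤ.- + 1) ℤ.+ (+ b ℤ.+ + 1) ≡ + c ℤ.+ + b
    rhs = solve 2 (λ x y → (x :- con (+ 1)) :+ (y :+ con (+ 1)) := x :+ y) refl (+ c) (+ b)

  l+[y+d]<4*l : ∀ {l y d h} → d < l → y < h → h ≤ d + d → l + (y + d) < 4 * l
  l+[y+d]<4*l {l} {y} {d} {h} d<l y<h h≤2d = begin-strict
    l + (y + d)       <⟨ +-monoʳ-< l (+-monoˡ-< d (<-≤-trans y<h h≤2d)) ⟩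
    l + (d + d + d)   ≤⟨ +-monoʳ-≤ l (+-mono-≤ (+-mono-≤ d≤l d≤l) d≤l) ⟩
    l + (l + l + l)   ≡⟨ l+[l+l+l]≡4*l l ⟩
    4 * l             ∎
    where
    open ≤-Reasoning
    d≤l : d ≤ l
    d≤l = <⇒≤ d<l
    l+[l+l+l]≡4*l : ∀ l → l + (l + l + l) ≡ 4 * l
    l+[l+l+l]≡4*l = ℕ-Ring.solve-∀

module Lemmas {c ℓ : Level} (G : FiniteAbelianGroup c ℓ) where
  open FiniteAbelianGroup G hiding (refl) renaming (sym to ≈-sym; trans to ≈-trans)
  open Notions G hiding (_+_)
  open import Data.Nat using (_+_)
  open Arithmetic
  open import Algebra.Properties.AbelianGroup abelianGroup
    using (⁻¹-anti-homo‿-; xyx⁻¹≈y; //-rightDividesʳ; ∙-cancelʳ)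
  open import Algebra.Properties.CommutativeSemigroup commutativeSemigroup
    using (x∙yz≈yx∙z; xy∙z≈xz∙y)

  variable
    x y : Carrier

  x-[x-y]≈y : ∀ x y → x - (x - y) ≈ y
  x-[x-y]≈y x y =
    ≈-trans (∙-congˡ (⁻¹-anti-homo‿- x y)) (≈-trans (x∙yz≈yx∙z x y (x ⁻¹)) (//-rightDividesʳ x y))

  _∩_ : Subset → Subset → Subset
  mem (A ∩ B) x = mem A x ∧ mem B x
  resp (A ∩ B) x≈y = cong₂ _∧_ (resp A x≈y) (resp B x≈y)

  _∖_ : Subset → Subset → Subset
  mem (A ∖ B) x = mem A x ∧ not (mem B x)
  resp (A ∖ B) x≈y = cong₂ _∧_ (resp A x≈y) (cong not (resp B x≈y))

  ∁ : Subset → Subset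
  ∁ A = Univ ∖ A

  coset : Carrier → Subset → Subset
  mem (coset g K) x = mem K (x - g)
  resp (coset g K) x≈y = resp K (∙-congʳ x≈y)

  ∈∩⁺ : ∀ A B → x ∈ A → x ∈ B → x ∈ (A ∩ B)
  ∈∩⁺ _ _ x∈A x∈B = cong₂ _∧_ x∈A x∈B

  ∈∩⁻ : ∀ A B → x ∈ (A ∩ B) → x ∈ A × x ∈ B
  ∈∩⁻ _ _ p = ∧-conicalˡ _ _ p , ∧-conicalʳ _ _ p

  ∈∖⁺ : ∀ A B → x ∈ A → x ∉ B → x ∈ (A ∖ B)
  ∈∖⁺ _ _ x∈A x∉B = cong₂ _∧_ x∈A (cong not x∉B)

  ∈∖⁻ : ∀ A B → x ∈ (A ∖ B) → x ∈ A × x ∉ B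
  ∈∖⁻ _ _ p = ∧-conicalˡ _ _ p , not-injective (∧-conicalʳ _ _ p)

  ∉⇒¬∈ : ∀ A → x ∉ A → ¬ x ∈ A
  ∉⇒¬∈ _ x∉A x∈A with trans (sym x∉A) x∈A
  ... | ()

  ¬∈⇒∉ : ∀ A → ¬ x ∈ A → x ∉ A
  ¬∈⇒∉ _ = ¬-not

  ∈∁⁺ : ∀ A → x ∉ A → x ∈ ∁ A
  ∈∁⁺ _ x∉A = cong not x∉A

  ∖-monoˡ : ∀ A B C → A ⊆ B → (A ∖ C) ⊆ (B ∖ C)
  ∖-monoˡ A B C A⊆B x p = ∈∖⁺ B C (A⊆B x x∈A) x∉C
    where
    x∈A : x ∈ A
    x∈A = proj₁ (∈∖⁻ A C p)
    x∉C : x ∉ C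
    x∉C = proj₂ (∈∖⁻ A C p)

  module _ {K : Subset} (K≤G : IsSubgroup K) where
    open IsSubgroup K≤G

    ∈-∈⇒∈ : x ∈ K → y ∈ K → (x - y) ∈ K
    ∈-∈⇒∈ x∈K y∈K = closed+ _ _ x∈K (closed- _ y∈K)

    ∈-∉⇒∉ : x ∈ K → y ∉ K → (x - y) ∉ K
    ∈-∉⇒∉ {x} {y} x∈K y∉K = ¬∈⇒∉ K λ x-y∈K →
      ∉⇒¬∈ K y∉K (trans (sym (resp K (x-[x-y]≈y x y))) (∈-∈⇒∈ x∈K x-y∈K))

    ∈∙∉⇒∉ : x ∈ K → y ∉ K → (x ∙ y) ∉ K
    ∈∙∉⇒∉ {x} {y} x∈K y∉K = ¬∈⇒∉ K λ x∙y∈K →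
      ∉⇒¬∈ K y∉K (trans (sym (resp K (xyx⁻¹≈y x y))) (∈-∈⇒∈ x∙y∈K x∈K))

  ∈⊕⁺ : ∀ A B {a} → a ∈ A → (x - a) ∈ B → x ∈ (A ⊕ B)
  ∈⊕⁺ {x} A B {a} a∈A x-a∈B = Equivalence.to T-≡ (any⁺ _ (Any.map witness (complete a)))
    where
    witness : ∀ {a′} → a ≈ a′ → _
    witness a≈a′ = Equivalence.from T-≡ (cong₂ _∧_
      (trans (sym (resp A a≈a′)) a∈A)
      (trans (sym (resp B (∙-congˡ (⁻¹-cong a≈a′)))) x-a∈B))

  ⊆-⊕ : ∀ {K} → IsSubgroup K → ∀ A → A ⊆ (A ⊕ K)
  ⊆-⊕ {K} K≤G A x x∈A =
    ∈⊕⁺ A K x∈A (trans (resp K (inverseʳ x)) (IsSubgroup.has-0 K≤G))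

  countIn-split : ∀ (P Q : Carrier → Bool) xs →
    countIn P xs ≡ countIn (λ x → P x ∧ Q x) xs + countIn (λ x → P x ∧ not (Q x)) xs
  countIn-split P Q [] = refl
  countIn-split P Q (x ∷ xs) with P x | Q x
  ... | true  | true  = cong suc (countIn-split P Q xs)
  ... | true  | false = trans (cong suc (countIn-split P Q xs)) (sym (+-suc _ _))
  ... | false | _     = countIn-split P Q xs

  ∣∣-split : ∀ A B → ∣ A ∣ ≡ ∣ A ∩ B ∣ + ∣ A ∖ B ∣
  ∣∣-split A B = countIn-split (mem A) (mem B) enum

  private
    Hit : (Carrier → Bool) → Carrier → Carrier → Set ℓ
    Hit Q a y = a ≈ y × Q y ≡ true

    countIn-─ : ∀ Q {a} ys (p : Any (Hit Q a) ys) → countIn Q ys ≡ suc (countIn Q (ys ─ p))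
    countIn-─ Q (y ∷ ys) (here (_ , Qy)) rewrite Qy = refl
    countIn-─ Q (y ∷ ys) (there p) with Q y
    ... | true  = cong suc (countIn-─ Q ys p)
    ... | false = countIn-─ Q ys p

    Any-─ : ∀ {Q a b} ys (p : Any (Hit Q a) ys) → ¬ a ≈ b →
            Any (Hit Q b) ys → Any (Hit Q b) (ys ─ p)
    Any-─ (y ∷ ys) (here (a≈y , _)) a≉b (here (b≈y , _)) =
      ⊥-elim (a≉b (≈-trans a≈y (≈-sym b≈y)))
    Any-─ (y ∷ ys) (here _)  a≉b (there q) = q
    Any-─ (y ∷ ys) (there p) a≉b (here q)  = here q
    Any-─ (y ∷ ys) (there p) a≉b (there q) = there (Any-─ ys p a≉b q)

  countIn-≤-injection : (f : Carrier → Carrier) → (∀ {x y} → f x ≈ f y → x ≈ y) →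
    ∀ {P Q} xs ys → AllPairs (λ a b → ¬ a ≈ b) xs →
    All (λ x → P x ≡ true → Any (Hit Q (f x)) ys) xs → countIn P xs ≤ countIn Q ys
  countIn-≤-injection f inj [] ys _ _ = z≤n
  countIn-≤-injection f inj {P} {Q} (x ∷ xs) ys (x≉xs ∷ xs-distinct) (hit-x ∷ hits) with P x
  ... | false = countIn-≤-injection f inj xs ys xs-distinct hits
  ... | true  = subst (suc (countIn P xs) ≤_) (sym (countIn-─ Q ys p))
                  (s≤s (countIn-≤-injection f inj xs (ys ─ p) xs-distinct hits′))
    where
    p : Any (Hit Q (f x)) ys
    p = hit-x refl
    hits′ : All (λ z → P z ≡ true → Any (Hit Q (f z)) (ys ─ p)) xs
    hits′ = All.zipWith (λ (x≉z , hit-z) Pz → Any-─ ys p (x≉z ∘ inj) (hit-z Pz)) (x≉xs , hits)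

  ∣∣-≤-injection : ∀ A B (f : Carrier → Carrier) → (∀ {x y} → f x ≈ f y → x ≈ y) →
    (∀ x → x ∈ A → f x ∈ B) → ∣ A ∣ ≤ ∣ B ∣
  ∣∣-≤-injection A B f inj A→B = countIn-≤-injection f inj enum enum distinct
    (All.tabulate λ {x} _ x∈A →
      Any.map (λ fx≈y → fx≈y , trans (sym (resp B fx≈y)) (A→B x x∈A)) (complete (f x)))

  ∣∣-mono : ∀ A B → A ⊆ B → ∣ A ∣ ≤ ∣ B ∣
  ∣∣-mono A B = ∣∣-≤-injection A B id id

  ∣∣-≤-translate : ∀ A B t → (∀ x → x ∈ A → (x ∙ t) ∈ B) → ∣ A ∣ ≤ ∣ B ∣
  ∣∣-≤-translate A B t = ∣∣-≤-injection A B (_∙ t) (∙-cancelʳ t _ _)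

  ∣coset∣≤∣K∣ : ∀ g K → ∣ coset g K ∣ ≤ ∣ K ∣
  ∣coset∣≤∣K∣ g K = ∣∣-≤-translate (coset g K) K (g ⁻¹) (λ _ x-g∈K → x-g∈K)

  ∣[S⊕K]∖S∣<∣K∣ : ∀ S {K} → IsSubgroup K →
    (+ ∣ S ⊕ K ∣) ℤ.- (+ ∣ S ∣) ℤ.≤ (+ ∣ K ∣) ℤ.- (+ 1) → ∣ (S ⊕ K) ∖ S ∣ < ∣ K ∣
  ∣[S⊕K]∖S∣<∣K∣ S {K} K≤G small = +-cancelʳ-< ∣ S ∣ _ _ (begin-strict
    ∣ (S ⊕ K) ∖ S ∣ + ∣ S ∣            ≡⟨ +-comm _ ∣ S ∣ ⟩
    ∣ S ∣ + ∣ (S ⊕ K) ∖ S ∣            ≤⟨ +-mono-≤ S≤ ≤-refl ⟩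
    ∣ (S ⊕ K) ∩ S ∣ + ∣ (S ⊕ K) ∖ S ∣  ≡⟨ sym (∣∣-split (S ⊕ K) S) ⟩
    ∣ S ⊕ K ∣                          <⟨ +a-+b≤+c-1⇒a<c+b (∣ S ⊕ K ∣) (∣ S ∣) (∣ K ∣) small ⟩
    ∣ K ∣ + ∣ S ∣                      ∎)
    where
    open ≤-Reasoning
    S≤ : ∣ S ∣ ≤ ∣ (S ⊕ K) ∩ S ∣
    S≤ = ∣∣-mono S ((S ⊕ K) ∩ S) λ x x∈S → ∈∩⁺ (S ⊕ K) S (⊆-⊕ K≤G S x x∈S) x∈S

  ∣K∖S∣≤∣[S⊕H]∖S∣+∣∁K∖S∣ : ∀ S {H K h} → IsSubgroup H → IsSubgroup K → h ∈ H → h ∉ K →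
    ∣ K ∖ S ∣ ≤ ∣ (S ⊕ H) ∖ S ∣ + ∣ ∁ K ∖ S ∣
  ∣K∖S∣≤∣[S⊕H]∖S∣+∣∁K∖S∣ S {H} {K} {h} H≤G K≤G h∈H h∉K = begin
    ∣ K ∖ S ∣                                      ≡⟨ ∣∣-split (K ∖ S) (S ⊕ H) ⟩
    ∣ (K ∖ S) ∩ (S ⊕ H) ∣ + ∣ (K ∖ S) ∖ (S ⊕ H) ∣  ≤⟨ +-mono-≤ inside outside ⟩
    ∣ (S ⊕ H) ∖ S ∣ + ∣ ∁ K ∖ S ∣                  ∎
    where
    open ≤-Reasoning
    inside : ∣ (K ∖ S) ∩ (S ⊕ H) ∣ ≤ ∣ (S ⊕ H) ∖ S ∣
    inside = ∣∣-mono ((K ∖ S) ∩ (S ⊕ H)) ((S ⊕ H) ∖ S) λ x p →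
      let (x∈K∖S , x∈S⊕H) = ∈∩⁻ (K ∖ S) (S ⊕ H) p
      in ∈∖⁺ (S ⊕ H) S x∈S⊕H (proj₂ (∈∖⁻ K S x∈K∖S))
    outside : ∣ (K ∖ S) ∖ (S ⊕ H) ∣ ≤ ∣ ∁ K ∖ S ∣
    outside = ∣∣-≤-translate ((K ∖ S) ∖ (S ⊕ H)) (∁ K ∖ S) (h ⁻¹) λ x p →
      let (x∈K∖S , x∉S⊕H) = ∈∖⁻ (K ∖ S) (S ⊕ H) p
          x∈K = proj₁ (∈∖⁻ K S x∈K∖S)
          x-h∉S = ¬∈⇒∉ S λ x-h∈S →
            ∉⇒¬∈ (S ⊕ H) x∉S⊕H (∈⊕⁺ S H x-h∈S (trans (resp H (x-[x-y]≈y x h)) h∈H))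
      in ∈∖⁺ (∁ K) S (∈∁⁺ K (∈-∉⇒∉ K≤G x∈K h∉K)) x-h∉S

  ∣H∣≤2∣[g+H]∖K∣ : ∀ {H K h} → IsSubgroup H → IsSubgroup K → h ∈ H → h ∉ K → ∀ g →
    ∣ H ∣ ≤ ∣ coset g H ∖ K ∣ + ∣ coset g H ∖ K ∣
  ∣H∣≤2∣[g+H]∖K∣ {H} {K} {h} H≤G K≤G h∈H h∉K g = begin
    ∣ H ∣                                    ≤⟨ ∣∣-≤-translate H (coset g H) g into-coset ⟩
    ∣ coset g H ∣                            ≡⟨ ∣∣-split (coset g H) K ⟩
    ∣ coset g H ∩ K ∣ + ∣ coset g H ∖ K ∣    ≤⟨ +-monoˡ-≤ _ shift-out ⟩
    ∣ coset g H ∖ K ∣ + ∣ coset g H ∖ K ∣    ∎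
    where
    open ≤-Reasoning
    into-coset : ∀ x → x ∈ H → (x ∙ g) ∈ coset g H
    into-coset x x∈H = trans (resp H (//-rightDividesʳ g x)) x∈H
    shift-out : ∣ coset g H ∩ K ∣ ≤ ∣ coset g H ∖ K ∣
    shift-out = ∣∣-≤-translate (coset g H ∩ K) (coset g H ∖ K) h λ y p →
      let (y∈g+H , y∈K) = ∈∩⁻ (coset g H) K p
          y∙h∈g+H = trans (resp H (xy∙z≈xz∙y y h (g ⁻¹))) (IsSubgroup.closed+ H≤G _ _ y∈g+H h∈H)
      in ∈∖⁺ (coset g H) K y∙h∈g+H (∈∙∉⇒∉ K≤G y∈K h∉K)

  coset∖K⊆∁K∖S : ∀ S {H} K {g} → IsSubgroup H → g ∉ (S ⊕ H) → (coset g H ∖ K) ⊆ (∁ K ∖ S)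
  coset∖K⊆∁K∖S S {H} K {g} H≤G g∉S⊕H x p =
    let (x∈g+H , x∉K) = ∈∖⁻ (coset g H) K p
        g-x∈H = trans (sym (resp H (⁻¹-anti-homo‿- x g))) (IsSubgroup.closed- H≤G _ x∈g+H)
        x∉S = ¬∈⇒∉ S λ x∈S → ∉⇒¬∈ (S ⊕ H) g∉S⊕H (∈⊕⁺ S H x∈S g-x∈H)
    in ∈∖⁺ (∁ K) S (∈∁⁺ K x∉K) x∉S

  small-doubling⇒⊆ : ∀ S L {G₀ H g₀ x₀} → IsSubgroup G₀ → IsSubgroup H →
    4 * ∣ L ∣ ≤ ∣ G₀ ∣ → ∁ G₀ ⊆ (S ⊕ L) → (G₀ ∩ S) ⊆ coset g₀ L →
    ∣ (S ⊕ L) ∖ S ∣ < ∣ L ∣ → ∣ (S ⊕ H) ∖ S ∣ < ∣ H ∣ → x₀ ∉ (S ⊕ H) → H ⊆ G₀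
  small-doubling⇒⊆ S L {G₀} {H} {g₀} {x₀} G₀≤G H≤G 4∣L∣≤∣G₀∣ ∁G₀⊆S⊕L G₀∩S⊆g₀+L X<L Y<H x₀∉S⊕H h h∈H
    with mem G₀ h in h∉G₀
  ... | true  = refl
  ... | false = ⊥-elim (<⇒≱ (l+[y+d]<4*l D<L Y<H H≤2D) (≤-trans 4∣L∣≤∣G₀∣ ∣G₀∣≤L+Y+D))
    where
    D : ℕ
    D = ∣ ∁ G₀ ∖ S ∣
    D<L : D < ∣ L ∣
    D<L = ≤-<-trans (∣∣-mono (∁ G₀ ∖ S) ((S ⊕ L) ∖ S) (∖-monoˡ (∁ G₀) (S ⊕ L) S ∁G₀⊆S⊕L)) X<L
    H≤2D : ∣ H ∣ ≤ D + D
    H≤2D = ≤-trans (∣H∣≤2∣[g+H]∖K∣ H≤G G₀≤G h∈H h∉G₀ x₀) (+-mono-≤ C≤D C≤D)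
      where
      C≤D : ∣ coset x₀ H ∖ G₀ ∣ ≤ D
      C≤D = ∣∣-mono (coset x₀ H ∖ G₀) (∁ G₀ ∖ S) (coset∖K⊆∁K∖S S G₀ H≤G x₀∉S⊕H)
    ∣G₀∣≤L+Y+D : ∣ G₀ ∣ ≤ ∣ L ∣ + (∣ (S ⊕ H) ∖ S ∣ + D)
    ∣G₀∣≤L+Y+D = begin
      ∣ G₀ ∣                          ≡⟨ ∣∣-split G₀ S ⟩
      ∣ G₀ ∩ S ∣ + ∣ G₀ ∖ S ∣         ≤⟨ +-mono-≤ ∣G₀∩S∣≤∣L∣ ∣G₀∖S∣≤Y+D ⟩
      ∣ L ∣ + (∣ (S ⊕ H) ∖ S ∣ + D)   ∎
      where
      open ≤-Reasoning
      ∣G₀∩S∣≤∣L∣ : ∣ G₀ ∩ S ∣ ≤ ∣ L ∣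
      ∣G₀∩S∣≤∣L∣ = ≤-trans (∣∣-mono (G₀ ∩ S) (coset g₀ L) G₀∩S⊆g₀+L) (∣coset∣≤∣K∣ g₀ L)
      ∣G₀∖S∣≤Y+D : ∣ G₀ ∖ S ∣ ≤ ∣ (S ⊕ H) ∖ S ∣ + D
      ∣G₀∖S∣≤Y+D = ∣K∖S∣≤∣[S⊕H]∖S∣+∣∁K∖S∣ S H≤G G₀≤G h∈H h∉G₀

  module _ (S L K : Subset) (g : Carrier)
           (S⊕L≡∁K∪g+L : ∀ x → mem (S ⊕ L) x ≡ (not (mem K x) ∨ mem L (x - g))) where

    ∁K⊆S⊕L : ∁ K ⊆ (S ⊕ L)
    ∁K⊆S⊕L x x∉K = trans (S⊕L≡∁K∪g+L x) (cong (_∨ mem L (x - g)) x∉K)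

    K∩S⊆g+L : IsSubgroup L → (K ∩ S) ⊆ coset g L
    K∩S⊆g+L L≤G x p =
      let (x∈K , x∈S) = ∈∩⁻ K S p
      in subst (λ b → not b ∨ mem L (x - g) ≡ true) x∈K
           (trans (sym (S⊕L≡∁K∪g+L x)) (⊆-⊕ L≤G S x x∈S))

lemma3 : ∀ {c ℓ} (G : FiniteAbelianGroup c ℓ) →
  let open FiniteAbelianGroup G
      open Notions G
  in (S L G₀ : Subset) (g₀ : Carrier) →
     (∃ λ x → x ∉ S) →
     IsSubgroup L → IsSubgroup G₀ → L ⊆ G₀ → g₀ ∈ G₀ →
     (∃ λ (k : ℕ) → (2 ≤ k) × (∣ G₀ ∣ ≡ (2 ^ k) * ∣ L ∣)) →
     (∃ λ c₀ → (c₀ ∈ G₀) × (∀ x → (x ∈ G₀) ⇔ (x ∈⟨ c₀ ⟩+ L))) →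
     (∀ x → (x ∈ G₀) ⇔ (x ∈⟨ g₀ ⟩+ L)) →
     (∀ x → (x + x) ∈ G₀) →
     (∃ λ (e : ℕ) → IsExponentMod Univ L e × IsExponentMod G₀ L e) →
     (∀ x → mem (S ⊕ L) x ≡ (not (mem G₀ x) ∨ mem L (x - g₀))) →
     ¬ (Σ Subset λ K → IsSubgroup K × (K ⊆ L) × (∃ λ y → (y ∈ L) × (y ∉ K)) ×
          (∃ λ a → ∀ x → x ∈ S → x ∈ g₀ +ₛ L → (x - a) ∈ K)) →
     ((+ ∣ S ⊕ L ∣) ℤ.- (+ ∣ S ∣) ℤ.≤ (+ ∣ L ∣) ℤ.- (+ 1)) →
     (H : Subset) → IsSubgroup H →
     ((+ ∣ S ⊕ H ∣) ℤ.- (+ ∣ S ∣) ℤ.≤ (+ ∣ H ∣) ℤ.- (+ 1)) →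
     (∃ λ x → x ∉ (S ⊕ H)) →
     H ⊆ G₀
lemma3 G S L G₀ g₀ _ L≤G G₀≤G _ _ (k , 2≤k , ∣G₀∣≡2^k*∣L∣) _ _ _ _ S⊕L≡ _ small-L
       H H≤G small-H (x₀ , x₀∉S⊕H) =
  small-doubling⇒⊆ S L G₀≤G H≤G 4∣L∣≤∣G₀∣ (∁K⊆S⊕L S L G₀ g₀ S⊕L≡) (K∩S⊆g+L S L G₀ g₀ S⊕L≡ L≤G)
    (∣[S⊕K]∖S∣<∣K∣ S L≤G small-L) (∣[S⊕K]∖S∣<∣K∣ S H≤G small-H) x₀∉S⊕H
  where
  open Lemmas G
  open Notions G using (∣_∣)
  4∣L∣≤∣G₀∣ : 4 * ∣ L ∣ ≤ ∣ G₀ ∣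
  4∣L∣≤∣G₀∣ = subst (_ ≤_) (sym ∣G₀∣≡2^k*∣L∣) (*-monoˡ-≤ _ (^-monoʳ-≤ 2 2≤k))
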